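{- Let $P$ be a finite propositional logic program such that every atom occurring negated in the body of some rule of $P$ is the head of some rule of $P$. Let $k\ge 0$ be an integer, let $P^k$ be the set of rules $r\in P$ with $|b^-(r)|\le k$, and let $M\subseteq \mathrm{At}(P)$ satisfy $|M|\ge |P|-k$. Then: (1) $M$ is a stable model of $P$ if and only if $M$ is a stable model of $P^k$; (2) if $M$ is a stable model of $P^k$, then at most $k+k^2$ distinct atoms occur negated in the bodies of the rules of $P^k$.
   Context: A logic program is a finite set of rules $r$ of the form $a \leftarrow b_1,\ldots,b_s,\mathbf{not}(c_1),\ldots,\mathbf{not}(c_t)$ with $a,b_i,c_j$ propositional atoms; $h(r)=a$, $b^+(r)=\{b_1,\ldots,b_s\}$, $b^-(r)=\{c_1,\ldots,c_t\}$. $\mathrm{At}(P)$ is the set of atoms occurring in $P$ and $|P|$ is the number of rules. For $M\subseteq\mathrm{At}(P)$, the reduct $P^M$ is obtained by deleting every rule $r$ with $b^-(r)\cap M\neq\emptyset$ and deleting all negated atoms from the remaining rules; $LM(P^M)$ is its least model. $M$ is a stable model of $P$ if $M=LM(P^M)$. -}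

module Defs where

open import Data.Nat using (ℕ; _≤_; _≤?_)
open import Data.Fin using (Fin)
open import Data.Fin.Subset using (Subset; _∈_; _⊆_; _∩_; ∣_∣; Empty; ⋃)
open import Data.List using (List; filter; map)
import Data.List.Membership.Propositional as L
open import Data.Product using (∃; _×_)
open import Data.Sum using (_⊎_)
open import Relation.Binary.PropositionalEquality using (_≡_)

record Rule (n : ℕ) : Set where
  constructor _←_∣_
  field
    head : Fin n
    pos  : Subset n
    neg  : Subset n
open Rule public

-- A logic program: a finite list of rules (duplicate-freeness imposed in the theorem)
Program : ℕ → Set
Program n = List (Rule n)

OccursIn : ∀ {n} → Program n → Fin n → Set
OccursIn P a = ∃ λ r → r L.∈ P × (a ≡ head r ⊎ a ∈ pos r ⊎ a ∈ neg r)

-- X is a model of the reduct P^M (a definite program):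
-- every rule r of P with b⁻(r) ∩ M = ∅ whose positive body holds in X has its head in X.
ModelOfReduct : ∀ {n} → Program n → Subset n → Subset n → Set
ModelOfReduct P M X = ∀ r → r L.∈ P → Empty (neg r ∩ M) → pos r ⊆ X → head r ∈ X

IsLeastModelOfReduct : ∀ {n} → Program n → Subset n → Subset n → Set
IsLeastModelOfReduct P M X = ModelOfReduct P M X × (∀ Y → ModelOfReduct P M Y → X ⊆ Y)

StableModel : ∀ {n} → Program n → Subset n → Set
StableModel P M = IsLeastModelOfReduct P M M

restrict : ∀ {n} → ℕ → Program n → Program n
restrict k P = filter (λ r → ∣ neg r ∣ ≤? k) P

negAtoms : ∀ {n} → Program n → Subset n
negAtoms P = ⋃ (map neg P)

-- A stable model M is contained in the set H of rule heads, and |H| ≤ |P| ≤ k + |M|,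
-- so at most k heads lie outside M.  A rule whose negative body misses M has all its
-- negated atoms among those heads (negated atoms are heads by hypothesis), hence has at
-- most k of them and survives in P^k: the reducts P^M and (P^k)^M coincide.  For the
-- count, M is covered by the heads of the applicable rules of P^k, so all but at most
-- k rules of P^k are applicable; the applicable ones contribute negated atoms only
-- from H ∖ M, and each of the remaining ≤ k rules contributes at most k.
module Submission where

open import Defs
open import Data.Nat using (ℕ; _+_; _*_; _∸_; _≤_; _≤?_; suc; z≤n; s≤s)
open import Data.Nat.Properties
  using (≤-trans; ≤-reflexive; +-suc; +-comm; n≤1+n; +-mono-≤; +-monoʳ-≤; *-monoˡ-≤; *-identityʳ;
         +-cancelˡ-≤; +-cancelʳ-≤; m≤n+m∸n; module ≤-Reasoning)
open import Data.Fin.Subset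
  using (Subset; _∈_; _⊆_; _∪_; _∩_; ∁; ⁅_⁆; ∣_∣; Empty; ⋃; inside; outside)
open import Data.Fin.Subset.Properties
  using (x∈p∪q⁻; x∈p∪q⁺; x∈⁅x⁆; x∈⁅y⁆⇒x≡y; ∉⊥; ∣⊥∣≡0; ∣⁅x⁆∣≡1; p⊆q⇒∣p∣≤∣q∣;
         x∈p∩q⁺; nonempty?; _⊆?_; x∉p⇒x∈∁p; ⊆-trans)
open import Data.List using ([]; _∷_; length; map; filter)
open import Data.List.Properties using (length-filter)
open import Data.List.Membership.Propositional using () renaming (_∈_ to _∈ₗ_)
open import Data.List.Membership.Propositional.Properties using (∈-filter⁺; ∈-filter⁻)
open import Data.List.Relation.Unary.Any using (here; there)
open import Data.List.Relation.Unary.Unique.Propositional using (Unique)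
open import Data.List.Relation.Ternary.Interleaving.Properties using (interleave-length)
open import Data.List.Relation.Ternary.Interleaving.Propositional.Properties using (filter⁺)
open import Data.Vec using (_∷_; [])
open import Data.Product using (∃; _×_; _,_; proj₁; proj₂)
open import Data.Sum using (inj₁; inj₂)
open import Function using (_∘_)
open import Function.Bundles using (_⇔_; mk⇔; Equivalence)
open import Relation.Binary.PropositionalEquality using (_≡_; refl; sym; subst; cong)
open import Relation.Nullary using (yes; no; ¬?; _×-dec_; contradiction)
open import Relation.Unary using (Decidable)

private
  variable
    n : ℕ

∣p∪q∣≤∣p∣+∣q∣ : (p q : Subset n) → ∣ p ∪ q ∣ ≤ ∣ p ∣ + ∣ q ∣
∣p∪q∣≤∣p∣+∣q∣ []            []            = z≤n
∣p∪q∣≤∣p∣+∣q∣ (inside ∷ p)  (inside ∷ q)  =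
  s≤s (≤-trans (∣p∪q∣≤∣p∣+∣q∣ p q) (+-monoʳ-≤ ∣ p ∣ (n≤1+n ∣ q ∣)))
∣p∪q∣≤∣p∣+∣q∣ (inside ∷ p)  (outside ∷ q) = s≤s (∣p∪q∣≤∣p∣+∣q∣ p q)
∣p∪q∣≤∣p∣+∣q∣ (outside ∷ p) (inside ∷ q)  rewrite +-suc ∣ p ∣ ∣ q ∣ = s≤s (∣p∪q∣≤∣p∣+∣q∣ p q)
∣p∪q∣≤∣p∣+∣q∣ (outside ∷ p) (outside ∷ q) = ∣p∪q∣≤∣p∣+∣q∣ p q

∣p∩∁q∣+∣q∣≡∣p∪q∣ : (p q : Subset n) → ∣ p ∩ ∁ q ∣ + ∣ q ∣ ≡ ∣ p ∪ q ∣
∣p∩∁q∣+∣q∣≡∣p∪q∣ []            []            = refl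
∣p∩∁q∣+∣q∣≡∣p∪q∣ (inside ∷ p)  (inside ∷ q)  rewrite +-suc ∣ p ∩ ∁ q ∣ ∣ q ∣ =
  cong suc (∣p∩∁q∣+∣q∣≡∣p∪q∣ p q)
∣p∩∁q∣+∣q∣≡∣p∪q∣ (inside ∷ p)  (outside ∷ q) = cong suc (∣p∩∁q∣+∣q∣≡∣p∪q∣ p q)
∣p∩∁q∣+∣q∣≡∣p∪q∣ (outside ∷ p) (inside ∷ q)  rewrite +-suc ∣ p ∩ ∁ q ∣ ∣ q ∣ =
  cong suc (∣p∩∁q∣+∣q∣≡∣p∪q∣ p q)
∣p∩∁q∣+∣q∣≡∣p∪q∣ (outside ∷ p) (outside ∷ q) = ∣p∩∁q∣+∣q∣≡∣p∪q∣ p q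

module _ {a} {A : Set a} (f : A → Subset n) where

  ∈-⋃-map⁺ : ∀ {xs x i} → x ∈ₗ xs → i ∈ f x → i ∈ ⋃ (map f xs)
  ∈-⋃-map⁺ (here refl) i∈ = x∈p∪q⁺ (inj₁ i∈)
  ∈-⋃-map⁺ (there x∈)  i∈ = x∈p∪q⁺ (inj₂ (∈-⋃-map⁺ x∈ i∈))

  ∈-⋃-map⁻ : ∀ xs {i} → i ∈ ⋃ (map f xs) → ∃ λ x → x ∈ₗ xs × i ∈ f x
  ∈-⋃-map⁻ []       i∈ = contradiction i∈ ∉⊥
  ∈-⋃-map⁻ (x ∷ xs) i∈ with x∈p∪q⁻ (f x) (⋃ (map f xs)) i∈
  ... | inj₁ i∈fx = x , here refl , i∈fx
  ... | inj₂ i∈⋃  = let y , y∈ , i∈fy = ∈-⋃-map⁻ xs i∈⋃ in y , there y∈ , i∈fy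

  ∣⋃-map∣≤length* : ∀ {k} xs → (∀ {x} → x ∈ₗ xs → ∣ f x ∣ ≤ k) → ∣ ⋃ (map f xs) ∣ ≤ length xs * k
  ∣⋃-map∣≤length* []       _     = ≤-reflexive (∣⊥∣≡0 n)
  ∣⋃-map∣≤length* (x ∷ xs) bound = ≤-trans (∣p∪q∣≤∣p∣+∣q∣ (f x) (⋃ (map f xs)))
    (+-mono-≤ (bound (here refl)) (∣⋃-map∣≤length* xs (bound ∘ there)))

heads : Program n → Subset n
heads P = ⋃ (map (⁅_⁆ ∘ head) P)

module _ {P : Program n} where

  head∈heads : ∀ {r} → r ∈ₗ P → head r ∈ heads P
  head∈heads r∈ = ∈-⋃-map⁺ (⁅_⁆ ∘ head) r∈ (x∈⁅x⁆ _)

  ∈-heads⁻ : ∀ {i} → i ∈ heads P → ∃ λ r → r ∈ₗ P × head r ≡ i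
  ∈-heads⁻ i∈ with ∈-⋃-map⁻ (⁅_⁆ ∘ head) P i∈
  ... | r , r∈ , i∈⁅hr⁆ = r , r∈ , sym (x∈⁅y⁆⇒x≡y _ i∈⁅hr⁆)

∣heads∣≤length : (P : Program n) → ∣ heads P ∣ ≤ length P
∣heads∣≤length P = subst (∣ heads P ∣ ≤_) (*-identityʳ (length P))
    (∣⋃-map∣≤length* (⁅_⁆ ∘ head) P (λ {r} _ → ≤-reflexive (∣⁅x⁆∣≡1 (head r))))

heads-mono : {P Q : Program n} → (∀ {r} → r ∈ₗ P → r ∈ₗ Q) → heads P ⊆ heads Q
heads-mono P⊆Q i∈ with ∈-heads⁻ i∈
... | r , r∈ , refl = head∈heads (P⊆Q r∈)

Applicable : Subset n → Rule n → Set
Applicable M r = Empty (neg r ∩ M) × pos r ⊆ M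

applicable? : (M : Subset n) → Decidable (Applicable M)
applicable? M r = ¬? (nonempty? (neg r ∩ M)) ×-dec (pos r ⊆? M)

module _ {P : Program n} {M : Subset n} where

  heads-modelOfReduct : ModelOfReduct P M (heads P)
  heads-modelOfReduct _ r∈ _ _ = head∈heads r∈

  stable⊆heads : StableModel P M → M ⊆ heads P
  stable⊆heads (_ , least) = least (heads P) heads-modelOfReduct

  stable⊆heads-applicable : StableModel P M → M ⊆ heads (filter (applicable? M) P)
  stable⊆heads-applicable (model , least) = least (heads A) headsA-model
    where
    A : Program n
    A = filter (applicable? M) P

    headsA⊆M : heads A ⊆ M
    headsA⊆M i∈ with ∈-heads⁻ i∈
    ... | r , r∈A , refl with ∈-filter⁻ (applicable? M) r∈A
    ...   | r∈P , unblocked , pos⊆M = model r r∈P unblocked pos⊆M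

    headsA-model : ModelOfReduct P M (heads A)
    headsA-model r r∈ unblocked pos⊆ =
      head∈heads (∈-filter⁺ (applicable? M) r∈ (unblocked , headsA⊆M ∘ pos⊆))

module _ {P Q : Program n} {M : Subset n}
         (Q⊆P : ∀ {r} → r ∈ₗ Q → r ∈ₗ P)
         (unblocked∈Q : ∀ {r} → r ∈ₗ P → Empty (neg r ∩ M) → r ∈ₗ Q) where

  stableModel-⇔ : StableModel P M ⇔ StableModel Q M
  stableModel-⇔ = mk⇔
    (λ (model , least) → P→Q model , λ Y → least Y ∘ Q→P)
    (λ (model , least) → Q→P model , λ Y → least Y ∘ P→Q)
    where
    P→Q : ∀ {X} → ModelOfReduct P M X → ModelOfReduct Q M X
    P→Q model r r∈ = model r (Q⊆P r∈)

    Q→P : ∀ {X} → ModelOfReduct Q M X → ModelOfReduct P M X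
    Q→P model r r∈ unblocked = model r (unblocked∈Q r∈ unblocked) unblocked

module Restriction {n} {P : Program n}
  (neg⊆heads : ∀ r → r ∈ₗ P → ∀ a → a ∈ neg r → ∃ λ r′ → r′ ∈ₗ P × head r′ ≡ a)
  (k : ℕ) (M : Subset n) (large : length P ∸ k ≤ ∣ M ∣) where

  Pᵏ : Program n
  Pᵏ = restrict k P

  ∣neg∣≤k? : Decidable {A = Rule n} (λ r → ∣ neg r ∣ ≤ k)
  ∣neg∣≤k? r = ∣ neg r ∣ ≤? k

  Pᵏ⊆P : ∀ {r} → r ∈ₗ Pᵏ → r ∈ₗ P
  Pᵏ⊆P r∈ = proj₁ (∈-filter⁻ ∣neg∣≤k? r∈)

  ∣neg∣≤k : ∀ {r} → r ∈ₗ Pᵏ → ∣ neg r ∣ ≤ k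
  ∣neg∣≤k r∈ = proj₂ (∈-filter⁻ ∣neg∣≤k? {xs = P} r∈)

  length≤k+∣M∣ : length P ≤ k + ∣ M ∣
  length≤k+∣M∣ = ≤-trans (m≤n+m∸n (length P) k) (+-monoʳ-≤ k large)

  module _ (M⊆H : M ⊆ heads P) where

    ∣H∩∁M∣≤k : ∣ heads P ∩ ∁ M ∣ ≤ k
    ∣H∩∁M∣≤k = +-cancelʳ-≤ ∣ M ∣ _ _ (begin
      ∣ heads P ∩ ∁ M ∣ + ∣ M ∣ ≡⟨ ∣p∩∁q∣+∣q∣≡∣p∪q∣ (heads P) M ⟩
      ∣ heads P ∪ M ∣           ≤⟨ p⊆q⇒∣p∣≤∣q∣ H∪M⊆H ⟩
      ∣ heads P ∣               ≤⟨ ∣heads∣≤length P ⟩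
      length P                  ≤⟨ length≤k+∣M∣ ⟩
      k + ∣ M ∣                 ∎)
      where
      open ≤-Reasoning
      H∪M⊆H : heads P ∪ M ⊆ heads P
      H∪M⊆H i∈ with x∈p∪q⁻ (heads P) M i∈
      ... | inj₁ i∈H = i∈H
      ... | inj₂ i∈M = M⊆H i∈M

    unblocked-neg⊆H∩∁M : ∀ {r} → r ∈ₗ P → Empty (neg r ∩ M) → neg r ⊆ heads P ∩ ∁ M
    unblocked-neg⊆H∩∁M {r} r∈ unblocked {a} a∈ with neg⊆heads r r∈ a a∈
    ... | r′ , r′∈ , refl =
      x∈p∩q⁺ (head∈heads r′∈ , x∉p⇒x∈∁p (λ a∈M → unblocked (a , x∈p∩q⁺ (a∈ , a∈M))))

    unblocked∈Pᵏ : ∀ {r} → r ∈ₗ P → Empty (neg r ∩ M) → r ∈ₗ Pᵏ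
    unblocked∈Pᵏ r∈ unblocked = ∈-filter⁺ ∣neg∣≤k? r∈
      (≤-trans (p⊆q⇒∣p∣≤∣q∣ (unblocked-neg⊆H∩∁M r∈ unblocked)) ∣H∩∁M∣≤k)

  stable⇔stableᵏ : StableModel P M ⇔ StableModel Pᵏ M
  stable⇔stableᵏ = mk⇔
    (λ st → Equivalence.to (equivalence (stable⊆heads st)) st)
    (λ st → Equivalence.from (equivalence (⊆-trans (stable⊆heads st) (heads-mono Pᵏ⊆P))) st)
    where
    equivalence : M ⊆ heads P → StableModel P M ⇔ StableModel Pᵏ M
    equivalence M⊆H = stableModel-⇔ Pᵏ⊆P (unblocked∈Pᵏ M⊆H)

  ∣negAtoms∣≤k+k*k : StableModel Pᵏ M → ∣ negAtoms Pᵏ ∣ ≤ k + k * k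
  ∣negAtoms∣≤k+k*k stable = begin
    ∣ negAtoms Pᵏ ∣                         ≤⟨ p⊆q⇒∣p∣≤∣q∣ negAtoms⊆ ⟩
    ∣ (heads P ∩ ∁ M) ∪ negAtoms blocked ∣   ≤⟨ ∣p∪q∣≤∣p∣+∣q∣ (heads P ∩ ∁ M) (negAtoms blocked) ⟩
    ∣ heads P ∩ ∁ M ∣ + ∣ negAtoms blocked ∣ ≤⟨ +-mono-≤ (∣H∩∁M∣≤k M⊆H) ∣negAtoms-blocked∣≤ ⟩
    k + length blocked * k                  ≤⟨ +-monoʳ-≤ k (*-monoˡ-≤ k length-blocked≤k) ⟩
    k + k * k                               ∎
    where
    open ≤-Reasoning

    applicable blocked : Program n
    applicable = filter (applicable? M) Pᵏ
    blocked    = filter (¬? ∘ applicable? M) Pᵏ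

    M⊆H : M ⊆ heads P
    M⊆H = ⊆-trans (stable⊆heads stable) (heads-mono Pᵏ⊆P)

    ∣M∣≤length-applicable : ∣ M ∣ ≤ length applicable
    ∣M∣≤length-applicable =
      ≤-trans (p⊆q⇒∣p∣≤∣q∣ (stable⊆heads-applicable stable)) (∣heads∣≤length applicable)

    length-blocked≤k : length blocked ≤ k
    length-blocked≤k = +-cancelˡ-≤ (length applicable) _ _ (begin
      length applicable + length blocked ≡⟨ interleave-length (filter⁺ (applicable? M) Pᵏ) ⟨
      length Pᵏ                         ≤⟨ length-filter ∣neg∣≤k? P ⟩
      length P                          ≤⟨ length≤k+∣M∣ ⟩
      k + ∣ M ∣                         ≤⟨ +-monoʳ-≤ k ∣M∣≤length-applicable ⟩
      k + length applicable             ≡⟨ +-comm k (length applicable) ⟩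
      length applicable + k             ∎)

    ∣negAtoms-blocked∣≤ : ∣ negAtoms blocked ∣ ≤ length blocked * k
    ∣negAtoms-blocked∣≤ = ∣⋃-map∣≤length* neg blocked
      (λ r∈ → ∣neg∣≤k (proj₁ (∈-filter⁻ (¬? ∘ applicable? M) {xs = Pᵏ} r∈)))

    negAtoms⊆ : negAtoms Pᵏ ⊆ (heads P ∩ ∁ M) ∪ negAtoms blocked
    negAtoms⊆ a∈ with ∈-⋃-map⁻ neg Pᵏ a∈
    ... | r , r∈ , a∈neg with applicable? M r
    ...   | yes (unblocked , _) =
      x∈p∪q⁺ (inj₁ (unblocked-neg⊆H∩∁M M⊆H (Pᵏ⊆P r∈) unblocked a∈neg))
    ...   | no ¬applicable =
      x∈p∪q⁺ (inj₂ (∈-⋃-map⁺ neg (∈-filter⁺ (¬? ∘ applicable? M) r∈ ¬applicable) a∈neg))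

mainTheorem2 : ∀ {n : ℕ} (P : Program n) → Unique P
    → (∀ r → r ∈ₗ P → ∀ a → a ∈ neg r → ∃ λ r′ → r′ ∈ₗ P × head r′ ≡ a)
    → (k : ℕ) (M : Subset n)
    → (∀ a → a ∈ M → OccursIn P a)
    → length P ∸ k ≤ ∣ M ∣
    → (StableModel P M ⇔ StableModel (restrict k P) M)
    × (StableModel (restrict k P) M → ∣ negAtoms (restrict k P) ∣ ≤ k + k * k)
mainTheorem2 P _ neg⊆heads k M _ large = stable⇔stableᵏ , ∣negAtoms∣≤k+k*k
  where open Restriction neg⊆heads k M large
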